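{- Let $G$ be a graph of order $n$ with a hamiltonian cycle $v_0v_1\ldots v_{n-1}v_0$ and maximum degree $\Delta$. Then the cycle spectrum $S(G)$ contains at least $\left\lceil\frac{\Delta}{2}\right\rceil$ distinct cycle lengths lying between $\frac{n+2}{2}$ and $n$ (inclusive).
   Context: All graphs are finite, simple and undirected. The cycle spectrum $S(G)$ of a graph $G$ is the set of lengths of cycles in $G$. A hamiltonian cycle is a cycle containing all vertices of $G$. -}

module Defs where

open import Data.Nat using (ℕ; zero; suc; _≤_; _+_; _*_; ⌈_/2⌉)
open import Data.Fin using (Fin; inject₁; fromℕ) renaming (zero to fzero; suc to fsuc)
open import Data.List using (List; length; filter; allFin)
open import Data.List.Membership.Propositional using (_∈_)
open import Data.List.Relation.Unary.Unique.Propositional using (Unique)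
open import Data.Product using (Σ; _×_; ∃)
open import Function.Definitions using (Injective)
open import Relation.Binary.PropositionalEquality using (_≡_)
open import Relation.Nullary using (¬_; Dec)

record Graph (n : ℕ) : Set₁ where
  field
    Adj     : Fin n → Fin n → Set
    adj?    : (u v : Fin n) → Dec (Adj u v)
    sym     : ∀ {u v} → Adj u v → Adj v u
    irrefl  : ∀ {u} → ¬ Adj u u
open Graph public

degree : ∀ {n} (G : Graph n) → Fin n → ℕ
degree {n} G v = length (filter (adj? G v) (allFin n))

IsMaxDegree : ∀ {n} → Graph n → ℕ → Set
IsMaxDegree {n} G Δ = (Σ (Fin n) λ v → degree G v ≡ Δ) × ((v : Fin n) → degree G v ≤ Δ)

record Cycle {n : ℕ} (G : Graph n) (k : ℕ) : Set where
  field
    m      : ℕ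
    len    : k ≡ suc m
    atLeast3 : 3 ≤ k
    vtx    : Fin (suc m) → Fin n
    inj    : Injective _≡_ _≡_ vtx
    step   : (i : Fin m) → Adj G (vtx (inject₁ i)) (vtx (fsuc i))
    close  : Adj G (vtx (fromℕ m)) (vtx fzero)

_∈S_ : ℕ → ∀ {n} → Graph n → Set
k ∈S G = Cycle G k

Hamiltonian : ∀ {n} → Graph n → Set
Hamiltonian {n} G = Cycle G n

-- Rotate the hamiltonian cycle so that a vertex v of maximum degree sits at position 0.
-- A neighbour at position a gives a chord splitting the cycle into arcs with a and n − a
-- edges, and the longer arc together with the chord is a cycle of length
-- 1 + max(a, n − a), which lies between (n + 2)/2 and n. Distinct neighbours have distinct
-- positions, and only the positions a and n − a give the same length, so the Δ
-- neighbours produce at least ⌈Δ/2⌉ distinct lengths.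
module Submission where

open import Defs renaming (sym to adj-sym)
open import Data.Nat using (ℕ; zero; suc; pred; _≤_; _<_; _+_; _*_; _∸_; _⊔_; ⌈_/2⌉; z≤n; s≤s; s≤s⁻¹; NonZero; >-nonZero⁻¹)
open import Data.Nat.Properties
open import Data.Nat.DivMod using (_%_; _mod_; %-distribˡ-+; [m+kn]%n≡m%n; m%n%n≡m%n; m<n⇒m%n≡m; m%n<n; n%n≡0)
open import Data.Nat.Tactic.RingSolver using (solve-∀)
open import Data.Fin using (Fin; toℕ; fromℕ<; inject₁; fromℕ; punchOut) renaming (zero to fzero; suc to fsuc)
open import Data.Fin.Properties using (toℕ-injective; toℕ<n; toℕ≤pred[n]; toℕ-fromℕ<; toℕ-inject₁; toℕ-fromℕ; any?; punchOut-injective; injective⇒≤) renaming (_≟_ to _≟ᶠ_)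
open import Data.List using (List; []; _∷_; length; filter; allFin; map)
open import Data.List.Properties using (length-filter; filter-all)
open import Data.List.Membership.Propositional using (_∈_)
open import Data.List.Membership.Propositional.Properties using (∈-filter⁻; ∈-map⁻)
open import Data.List.Relation.Binary.Subset.Propositional using (_⊆_)
open import Data.List.Relation.Binary.Subset.Propositional.Properties using (map⁺; filter-⊆; ∷⁺ʳ)
open import Data.List.Relation.Unary.All as All using (All; _∷_)
open import Data.List.Relation.Unary.AllPairs using ([]; _∷_)
open import Data.List.Relation.Unary.Unique.Propositional using (Unique)
open import Data.List.Relation.Unary.Unique.Propositional.Properties using (filter⁺; allFin⁺)
open import Data.Product using (Σ; ∃; _×_; _,_; proj₁; proj₂)
open import Data.Sum using (_⊎_; inj₁; inj₂)
open import Function using (_∘_)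
open import Function.Definitions using (Injective)
open import Relation.Binary.Definitions using (DecidableEquality)
open import Relation.Binary.PropositionalEquality
open import Relation.Nullary using (Dec; yes; no; ¬?; contradiction)

module _ {A B : Set} (_≟_ : DecidableEquality B) (f : A → B) (partner : A → A)
         (fibre : ∀ x y → f x ≡ f y → x ≡ y ⊎ y ≡ partner x) where

  private
    otherImage? : (x y : A) → Dec (f y ≢ f x)
    otherImage? x y = ¬? (f y ≟ f x)

    sameImage⇒partner : ∀ {x y} → x ≢ y → f y ≡ f x → y ≡ partner x
    sameImage⇒partner {x} {y} x≢y fy≡fx with fibre x y (sym fy≡fx)
    ... | inj₁ x≡y = contradiction x≡y x≢y
    ... | inj₂ y≡x′ = y≡x′

  length≤1+filter-otherImage : ∀ {x} xs → Unique xs → All (x ≢_) xs →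
                               length xs ≤ suc (length (filter (otherImage? x) xs))
  length≤1+filter-otherImage [] _ _ = z≤n
  length≤1+filter-otherImage {x} (y ∷ ys) (y∉ys ∷ uys) (x≢y ∷ x∉ys) with f y ≟ f x
  ... | no _ = s≤s (length≤1+filter-otherImage ys uys x∉ys)
  ... | yes fy≡fx = s≤s (≤-reflexive (sym (cong length (filter-all (otherImage? x) ys-otherImage))))
    where
    -- y is the partner of x, so no other element can share its image
    ys-otherImage : All (λ z → f z ≢ f x) ys
    ys-otherImage = All.zipWith (λ (y≢z , x≢z) fz≡fx →
      y≢z (trans (sameImage⇒partner x≢y fy≡fx) (sym (sameImage⇒partner x≢z fz≡fx)))) (y∉ys , x∉ys)

  image-≥-half : (xs : List A) → Unique xs →
                 ∃ λ ys → Unique ys × ⌈ length xs /2⌉ ≤ length ys × ys ⊆ map f xs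
  image-≥-half xs = bounded (length xs) xs ≤-refl
    where
    bounded : ∀ k xs → length xs ≤ k → Unique xs →
              ∃ λ ys → Unique ys × ⌈ length xs /2⌉ ≤ length ys × ys ⊆ map f xs
    bounded _ [] _ _ = [] , [] , z≤n , λ ()
    bounded (suc k) (x ∷ xs) (s≤s |xs|≤k) (x∉xs ∷ uxs)
      with ys , uys , ⌈xs′/2⌉≤ys , ys⊆ ← bounded k (filter (otherImage? x) xs)
             (≤-trans (length-filter (otherImage? x) xs) |xs|≤k) (filter⁺ (otherImage? x) uxs)
      = f x ∷ ys , fx∉ys ∷ uys , bound , ∷⁺ʳ (f x) (map⁺ f (filter-⊆ (otherImage? x) xs) ∘ ys⊆)
      where
      fx∉ys : All (f x ≢_) ys
      fx∉ys = All.tabulate λ y∈ys fx≡y →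
        let z , z∈ , y≡fz = ∈-map⁻ f (ys⊆ y∈ys)
        in proj₂ (∈-filter⁻ (otherImage? x) {xs = xs} z∈) (sym (trans fx≡y y≡fz))
      bound : ⌈ suc (length xs) /2⌉ ≤ suc (length ys)
      bound = ≤-trans (⌈n/2⌉-mono (s≤s (length≤1+filter-otherImage xs uxs x∉xs))) (s≤s ⌈xs′/2⌉≤ys)

longerArc : ℕ → ℕ → ℕ
longerArc n a = a ⊔ (n ∸ a)

longerArc-cases : ∀ n a → (n ∸ a ≤ a × longerArc n a ≡ a) ⊎ (a < n ∸ a × longerArc n a ≡ n ∸ a)
longerArc-cases n a with n ∸ a ≤? a
... | yes short = inj₁ (short , m≥n⇒m⊔n≡m short)
... | no long = inj₂ (≰⇒> long , m≤n⇒m⊔n≡n (<⇒≤ (≰⇒> long)))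

m<n∸m⇒m≤n : ∀ {m n} → m < n ∸ m → m ≤ n
m<n∸m⇒m≤n {m} {n} m<n∸m = ≤-trans (<⇒≤ m<n∸m) (m∸n≤m n m)

longerArc-fibre : ∀ n a b → longerArc n a ≡ longerArc n b → a ≡ b ⊎ b ≡ n ∸ a
longerArc-fibre n a b eq with longerArc-cases n a | longerArc-cases n b
... | inj₁ (_ , ea) | inj₁ (_ , eb) = inj₁ (trans (sym ea) (trans eq eb))
... | inj₁ (_ , ea) | inj₂ (b<n∸b , eb) =
  inj₂ (sym (trans (cong (n ∸_) (trans (sym ea) (trans eq eb))) (m∸[m∸n]≡n (m<n∸m⇒m≤n b<n∸b))))
... | inj₂ (_ , ea) | inj₁ (_ , eb) = inj₂ (trans (sym eb) (trans (sym eq) ea))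
... | inj₂ (a<n∸a , ea) | inj₂ (b<n∸b , eb) =
  inj₁ (∸-cancelˡ-≡ (m<n∸m⇒m≤n a<n∸a) (m<n∸m⇒m≤n b<n∸b) (trans (sym ea) (trans eq eb)))

n≤2*longerArc : ∀ n a → n ≤ 2 * longerArc n a
n≤2*longerArc n a = begin
  n                                  ≤⟨ m≤n+m∸n n a ⟩
  a + (n ∸ a)                        ≤⟨ +-mono-≤ (m≤m⊔n a (n ∸ a)) (m≤n⊔m a (n ∸ a)) ⟩
  longerArc n a + longerArc n a      ≡⟨ cong (longerArc n a +_) (+-identityʳ (longerArc n a)) ⟨
  2 * longerArc n a                  ∎
  where open ≤-Reasoning

n+2≤2*[1+longerArc] : ∀ n a → n + 2 ≤ 2 * suc (longerArc n a)
n+2≤2*[1+longerArc] n a = begin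
  n + 2                  ≡⟨ +-comm n 2 ⟩
  2 + n                  ≤⟨ +-monoʳ-≤ 2 (n≤2*longerArc n a) ⟩
  2 + 2 * longerArc n a  ≡⟨ *-suc 2 (longerArc n a) ⟨
  2 * suc (longerArc n a) ∎
  where open ≤-Reasoning

longerArc<n : ∀ {n a} → 0 < a → a < n → longerArc n a < n
longerArc<n {n} 0<a a<n = ⊔-pres-<m a<n (∸-monoʳ-< 0<a (<⇒≤ a<n))

module _ {d : ℕ} .{{_ : NonZero d}} where

  0%d≡0 : 0 % d ≡ 0
  0%d≡0 = m<n⇒m%n≡m (>-nonZero⁻¹ d)

  %-cong-+ : ∀ {i i′ j j′} → i % d ≡ i′ % d → j % d ≡ j′ % d → (i + j) % d ≡ (i′ + j′) % d
  %-cong-+ {i} {i′} {j} {j′} i≡i′ j≡j′ = begin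
    (i + j) % d              ≡⟨ %-distribˡ-+ i j d ⟩
    (i % d + j % d) % d      ≡⟨ cong₂ (λ x y → (x + y) % d) i≡i′ j≡j′ ⟩
    (i′ % d + j′ % d) % d    ≡⟨ %-distribˡ-+ i′ j′ d ⟨
    (i′ + j′) % d            ∎
    where open ≡-Reasoning

  [s+i+s*pred[d]]%d≡i%d : ∀ s i → (s + i + s * pred d) % d ≡ i % d
  [s+i+s*pred[d]]%d≡i%d s i = begin
    (s + i + s * pred d) % d       ≡⟨ cong (_% d) (rearrange s i (pred d)) ⟩
    (i + s * suc (pred d)) % d     ≡⟨ cong (λ e → (i + s * e) % d) (suc-pred d) ⟩
    (i + s * d) % d                ≡⟨ [m+kn]%n≡m%n i s d ⟩
    i % d                          ∎
    where
    open ≡-Reasoning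
    rearrange : ∀ s i e → s + i + s * e ≡ i + s * suc e
    rearrange = solve-∀

  +-cancelˡ-% : ∀ s {i j} → (s + i) % d ≡ (s + j) % d → i % d ≡ j % d
  +-cancelˡ-% s {i} {j} eq = begin
    i % d                     ≡⟨ [s+i+s*pred[d]]%d≡i%d s i ⟨
    (s + i + s * pred d) % d  ≡⟨ %-cong-+ eq refl ⟩
    (s + j + s * pred d) % d  ≡⟨ [s+i+s*pred[d]]%d≡i%d s j ⟩
    j % d                     ∎
    where open ≡-Reasoning

injective⇒surjective : ∀ {m} {f : Fin (suc m) → Fin (suc m)} → Injective _≡_ _≡_ f →
                       ∀ y → ∃ λ x → f x ≡ y
injective⇒surjective {m} {f} f-inj y with any? (λ x → f x ≟ᶠ y)
... | yes hit = hit
... | no miss = contradiction (injective⇒≤ punchOut∘f-injective) (<-irrefl refl)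
  where
  y≢f : ∀ x → y ≢ f x
  y≢f x y≡fx = miss (x , sym y≡fx)
  punchOut∘f : Fin (suc m) → Fin m
  punchOut∘f x = punchOut (y≢f x)
  punchOut∘f-injective : Injective _≡_ _≡_ punchOut∘f
  punchOut∘f-injective {x} {x′} eq = f-inj (punchOut-injective (y≢f x) (y≢f x′) eq)

-- A hamiltonian cycle read as a periodic walk through ℕ-indexed positions,
-- so that rotating it is just shifting the index.
record HamiltonianWalk {n} (G : Graph n) .{{_ : NonZero n}} : Set where
  field
    walk           : ℕ → Fin n
    walk-adj       : ∀ k → Adj G (walk k) (walk (suc k))
    walk-cong      : ∀ {i j} → i % n ≡ j % n → walk i ≡ walk j
    walk-injective : ∀ {i j} → walk i ≡ walk j → i % n ≡ j % n
    walk-onto      : ∀ u → ∃ λ k → walk k ≡ u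

open HamiltonianWalk

module _ {n} {G : Graph n} .{{_ : NonZero n}} where

  rotate : ℕ → HamiltonianWalk G → HamiltonianWalk G
  rotate s w = record
    { walk           = λ k → walk w (s + k)
    ; walk-adj       = λ k → subst (λ i → Adj G (walk w (s + k)) (walk w i)) (sym (+-suc s k)) (walk-adj w (s + k))
    ; walk-cong      = λ eq → walk-cong w (%-cong-+ refl eq)
    ; walk-injective = λ eq → +-cancelˡ-% s (walk-injective w eq)
    ; walk-onto      = λ u → let k , wk≡u = walk-onto w u in
        k + s * pred n , trans (walk-cong w (trans (cong (_% n) (sym (+-assoc s k _))) ([s+i+s*pred[d]]%d≡i%d s k))) wk≡u
    }

hamiltonianWalk : ∀ {n} {G : Graph n} .{{_ : NonZero n}} → Hamiltonian G → HamiltonianWalk G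
hamiltonianWalk {G = G} record { m = m ; len = refl ; vtx = vtx ; inj = inj ; step = step ; close = close } = record
  { walk           = walk′
  ; walk-adj       = walk′-adj
  ; walk-cong      = λ {i j} → walk′-cong {i} {j}
  ; walk-injective = λ {i j} → walk′-injective {i} {j}
  ; walk-onto      = λ u → let q , vq≡u = injective⇒surjective inj u in toℕ q , trans (walk′-toℕ q) vq≡u
  }
  where
  n = suc m
  walk′ : ℕ → Fin n
  walk′ k = vtx (k mod n)

  walk′-cong : ∀ {i j} → i % n ≡ j % n → walk′ i ≡ walk′ j
  walk′-cong {i} {j} eq = cong vtx (toℕ-injective (trans (toℕ-fromℕ< (m%n<n i n)) (trans eq (sym (toℕ-fromℕ< (m%n<n j n))))))

  walk′-injective : ∀ {i j} → walk′ i ≡ walk′ j → i % n ≡ j % n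
  walk′-injective {i} {j} eq = trans (sym (toℕ-fromℕ< (m%n<n i n))) (trans (cong toℕ (inj eq)) (toℕ-fromℕ< (m%n<n j n)))

  walk′-toℕ : ∀ q → walk′ (toℕ q) ≡ vtx q
  walk′-toℕ q = cong vtx (toℕ-injective (trans (toℕ-fromℕ< _) (m<n⇒m%n≡m (toℕ<n q))))

  adj-below : ∀ j → j < n → Adj G (walk′ j) (walk′ (suc j))
  adj-below j j<n with m≤n⇒m<n∨m≡n (s≤s⁻¹ j<n)
  ... | inj₁ j<m = subst (λ k → Adj G (walk′ k) (walk′ (suc k))) (toℕ-fromℕ< j<m) (adj-step (fromℕ< j<m))
    where
    adj-step : ∀ i → Adj G (walk′ (toℕ i)) (walk′ (suc (toℕ i)))
    adj-step i = subst₂ (Adj G)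
      (trans (sym (walk′-toℕ (inject₁ i))) (cong walk′ (toℕ-inject₁ i))) (sym (walk′-toℕ (fsuc i))) (step i)
  ... | inj₂ refl = subst₂ (Adj G)
      (trans (sym (walk′-toℕ (fromℕ m))) (cong walk′ (toℕ-fromℕ m))) (walk′-cong {0} {n} (sym (n%n≡0 n))) close

  walk′-adj : ∀ k → Adj G (walk′ k) (walk′ (suc k))
  walk′-adj k = subst₂ (Adj G) (walk′-cong {k % n} {k} (m%n%n≡m%n k n))
    (walk′-cong {suc (k % n)} {suc k} (%-cong-+ {i = 1} {i′ = 1} {j = k % n} {j′ = k} refl (m%n%n≡m%n k n)))
    (adj-below (k % n) (m%n<n k n))

module _ {n} {G : Graph n} .{{_ : NonZero n}} where

  walk-injective-< : (w : HamiltonianWalk G) → ∀ {i j} → i < n → j < n → walk w i ≡ walk w j → i ≡ j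
  walk-injective-< w {i} {j} i<n j<n eq =
    trans (sym (m<n⇒m%n≡m i<n)) (trans (walk-injective w eq) (m<n⇒m%n≡m j<n))

  chordCycle : (w : HamiltonianWalk G) → ∀ {a} → 2 ≤ a → a < n →
               Adj G (walk w 0) (walk w a) → Cycle G (suc a)
  chordCycle w {a} 2≤a a<n chord = record
    { m        = a
    ; len      = refl
    ; atLeast3 = s≤s 2≤a
    ; vtx      = walk w ∘ toℕ
    ; inj      = λ {x} {y} eq → toℕ-injective (walk-injective-< w (below x) (below y) eq)
    ; step     = λ i → subst (λ k → Adj G (walk w k) (walk w (suc (toℕ i)))) (sym (toℕ-inject₁ i)) (walk-adj w (toℕ i))
    ; close    = subst (λ k → Adj G (walk w k) (walk w 0)) (sym (toℕ-fromℕ a)) (adj-sym G chord)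
    }
    where
    below : (x : Fin (suc a)) → toℕ x < n
    below x = ≤-<-trans (toℕ≤pred[n] x) a<n

  longChordCycle : (w : HamiltonianWalk G) → ∀ {a} → 3 ≤ n → 0 < a → a < n →
                   Adj G (walk w 0) (walk w a) → Cycle G (suc (longerArc n a))
  longChordCycle w {a} 3≤n 0<a a<n chord with longerArc-cases n a
  ... | inj₁ (n∸a≤a , longer≡a) =
    subst (Cycle G ∘ suc) (sym longer≡a) (chordCycle w 2≤a a<n chord)
    where
    2≤a : 2 ≤ a
    2≤a = 3≤a+a⇒2≤a (≤-trans 3≤n (≤-trans (m≤n+m∸n n a) (+-monoʳ-≤ a n∸a≤a)))
      where
      3≤a+a⇒2≤a : ∀ {a} → 3 ≤ a + a → 2 ≤ a
      3≤a+a⇒2≤a {suc (suc _)} _ = s≤s (s≤s z≤n)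
      3≤a+a⇒2≤a {suc zero} (s≤s (s≤s ()))
  ... | inj₂ (a<n∸a , longer≡n∸a) =
    subst (Cycle G ∘ suc) (sym longer≡n∸a) (chordCycle (rotate a w) (≤-trans (s≤s 0<a) a<n∸a) (∸-monoʳ-< 0<a (<⇒≤ a<n)) chord′)
    where
    -- in the walk rotated to start at walk a, the index n ∸ a lands back on walk 0
    chord′ : Adj G (walk w (a + 0)) (walk w (a + (n ∸ a)))
    chord′ = subst₂ (Adj G)
      (cong (walk w) (sym (+-identityʳ a)))
      (walk-cong w (trans 0%d≡0 (sym (trans (cong (_% n) (m+[n∸m]≡n (<⇒≤ a<n))) (n%n≡0 n)))))
      (adj-sym G chord)

  startingAt : HamiltonianWalk G → ∀ v → Σ (HamiltonianWalk G) λ w → walk w 0 ≡ v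
  startingAt w v = let p , wp≡v = walk-onto w v in rotate p w , trans (cong (walk w) (+-identityʳ p)) wp≡v

  position : HamiltonianWalk G → Fin n → ℕ
  position w u = proj₁ (walk-onto w u) % n

  walk-position : ∀ w u → walk w (position w u) ≡ u
  walk-position w u = let k , wk≡u = walk-onto w u in trans (walk-cong w (m%n%n≡m%n k n)) wk≡u

  longChordLengths : (w : HamiltonianWalk G) → 3 ≤ n →
    Σ (List ℕ) λ L → Unique L × ⌈ degree G (walk w 0) /2⌉ ≤ length L ×
      ((ℓ : ℕ) → ℓ ∈ L → (n + 2 ≤ 2 * ℓ) × ℓ ≤ n × ℓ ∈S G)
  longChordLengths w 3≤n =
    let L , uL , bound , L⊆ = image-≥-half _≟_ chordLength partner fibre neighbours
                                (filter⁺ (adj? G v) (allFin⁺ n))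
    in L , uL , bound , λ ℓ ℓ∈L → let u , u∈ , ℓ≡ = ∈-map⁻ chordLength (L⊆ ℓ∈L) in
         subst (λ ℓ → (n + 2 ≤ 2 * ℓ) × ℓ ≤ n × ℓ ∈S G) (sym ℓ≡)
           (longChord u (proj₂ (∈-filter⁻ (adj? G v) {xs = allFin n} u∈)))
    where
    v = walk w 0
    neighbours = filter (adj? G v) (allFin n)

    chordLength : Fin n → ℕ
    chordLength u = suc (longerArc n (position w u))

    partner : Fin n → Fin n
    partner u = walk w (n ∸ position w u)

    fibre : ∀ u u′ → chordLength u ≡ chordLength u′ → u ≡ u′ ⊎ u′ ≡ partner u
    fibre u u′ eq with longerArc-fibre n (position w u) (position w u′) (suc-injective eq)
    ... | inj₁ same = inj₁ (trans (sym (walk-position w u)) (trans (cong (walk w) same) (walk-position w u′)))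
    ... | inj₂ opposite = inj₂ (trans (sym (walk-position w u′)) (cong (walk w) opposite))

    longChord : ∀ u → Adj G v u → (n + 2 ≤ 2 * chordLength u) × chordLength u ≤ n × Cycle G (chordLength u)
    longChord u vu = n+2≤2*[1+longerArc] n a , longerArc<n 0<a a<n , longChordCycle w 3≤n 0<a a<n chord
      where
      a = position w u
      a<n : a < n
      a<n = m%n<n _ n
      chord : Adj G v (walk w a)
      chord = subst (Adj G v) (sym (walk-position w u)) vu
      0<a : 0 < a
      0<a with a in a≡
      ... | suc _ = s≤s z≤n
      ... | zero = contradiction (subst (Adj G v) (cong (walk w) a≡) chord) (irrefl G)

lemma2 : (n : ℕ) (G : Graph n) (Δ : ℕ) → Hamiltonian G → IsMaxDegree G Δ →
    Σ (List ℕ) λ L → Unique L × ⌈ Δ /2⌉ ≤ length L ×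
    ((ℓ : ℕ) → ℓ ∈ L → (n + 2 ≤ 2 * ℓ) × ℓ ≤ n × ℓ ∈S G)
lemma2 n G Δ ham@record { len = refl ; atLeast3 = 3≤n } ((v , degree-v≡Δ) , _)
  with w , w₀≡v ← startingAt (hamiltonianWalk ham) v
  with L , uL , bound , cycles ← longChordLengths w 3≤n
  = L , uL , subst (λ d → ⌈ d /2⌉ ≤ length L) (trans (cong (degree G) w₀≡v) degree-v≡Δ) bound , cycles
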